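{- Let $G$ be a graph, $k$ an integer, and let $u$ and $v$ be two adjacent vertices of $G$ each of degree at most 2. Let $G'$ be the graph obtained from $G$ by deleting the edge $uv$. Then $(G,k)$ is a yes-instance of Co-Path/Cycle Packing if and only if $(G',k)$ is a yes-instance of Co-Path/Cycle Packing.
   Context: Co-Path/Cycle Packing: given a simple undirected graph $G=(V,E)$ and an integer $k$, decide whether there is $S\subseteq V$ with $|S|\le k$ such that $G\setminus S$ has maximum degree at most 2. -}

module Defs where

open import Data.Nat using (ℕ; _≤_)
open import Data.Bool using (Bool; true; false; _∧_; _∨_; not)
open import Data.Bool.Properties using (∧-comm; ∨-comm)
open import Data.Fin using (Fin)
open import Data.Fin.Subset using (Subset; _∉_; ∣_∣; _∩_; ∁)
open import Data.Vec using (tabulate)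
open import Data.Fin.Properties using (_≟_)
open import Data.Integer using (ℤ; +_) renaming (_≤_ to _≤ℤ_)
open import Data.Product using (Σ; _×_)
open import Relation.Binary.PropositionalEquality using (_≡_; cong; cong₂)
open import Relation.Nullary using (¬_; does)

record Graph (n : ℕ) : Set where
  field
    adj   : Fin n → Fin n → Bool
    sym   : ∀ u v → adj u v ≡ adj v u
    irrefl : ∀ v → adj v v ≡ false
open Graph public

nbhd : ∀ {n} → Graph n → Fin n → Subset n
nbhd G v = tabulate (adj G v)

degree : ∀ {n} → Graph n → Fin n → ℕ
degree G v = ∣ nbhd G v ∣

degreeMinus : ∀ {n} → Graph n → Subset n → Fin n → ℕ
degreeMinus G S v = ∣ nbhd G v ∩ ∁ S ∣

MaxDeg≤2After : ∀ {n} → Graph n → Subset n → Set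
MaxDeg≤2After G S = ∀ v → v ∉ S → degreeMinus G S v ≤ 2

CoPathCyclePacking : ∀ {n} → Graph n → ℤ → Set
CoPathCyclePacking {n} G k = Σ (Subset n) λ S → (+ ∣ S ∣ ≤ℤ k) × MaxDeg≤2After G S

isUV : ∀ {n} → Fin n → Fin n → Fin n → Fin n → Bool
isUV u v x y = (does (x ≟ u) ∧ does (y ≟ v)) ∨ (does (x ≟ v) ∧ does (y ≟ u))

isUV-sym : ∀ {n} (u v x y : Fin n) → isUV u v x y ≡ isUV u v y x
isUV-sym u v x y
  rewrite ∧-comm (does (x ≟ u)) (does (y ≟ v))
        | ∧-comm (does (x ≟ v)) (does (y ≟ u))
        = ∨-comm (does (y ≟ v) ∧ does (x ≟ u)) (does (y ≟ u) ∧ does (x ≟ v))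

deleteEdge : ∀ {n} → (G : Graph n) → Fin n → Fin n → Graph n
deleteEdge G u v = record
  { adj = λ x y → adj G x y ∧ not (isUV u v x y)
  ; sym = λ x y → cong₂ (λ a b → a ∧ not b) (Graph.sym G x y) (isUV-sym u v x y)
  ; irrefl = λ x → cong (λ a → a ∧ not (isUV u v x x)) (irrefl G x) }

-- Deleting uv can only lower degrees, so a solution for G is one for G - uv.
-- Conversely, only the degrees of u and v change, and those are at most 2
-- already in G, so a solution for G - uv is one for G with the same S.
module Submission where

open import Defs hiding (sym)
open import Data.Nat using (ℕ; _≤_)
open import Data.Nat.Properties using (≤-trans)
open import Data.Fin using (Fin)
open import Data.Fin.Properties using (_≟_)
open import Data.Fin.Subset using (Subset; _⊆_; _∩_; ∁; ∣_∣)
open import Data.Fin.Subset.Properties using (p⊆q⇒∣p∣≤∣q∣; x∈p∩q⁺; x∈p∩q⁻; ∣p∩q∣≤∣p∣)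
open import Data.Vec using (tabulate)
open import Data.Vec.Properties using ([]=⇒lookup; lookup⇒[]=; lookup∘tabulate; tabulate-cong)
open import Data.Integer using (ℤ)
open import Data.Bool using (Bool; true; false; _∧_; not)
open import Data.Bool.Properties using (∧-identityʳ)
open import Data.Product using (_,_)
open import Data.Empty using (⊥-elim)
open import Relation.Nullary using (¬_; yes; no)
open import Relation.Binary.PropositionalEquality using (_≡_; refl; sym; trans; cong; subst)
open import Function.Bundles using (_⇔_; mk⇔)

private
  variable
    n : ℕ

tabulate-mono : (f g : Fin n → Bool) → (∀ y → f y ≡ true → g y ≡ true) →
                tabulate f ⊆ tabulate g
tabulate-mono f g f⇒g {y} y∈f = lookup⇒[]= y (tabulate g)
  (trans (lookup∘tabulate g y)
         (f⇒g y (trans (sym (lookup∘tabulate f y)) ([]=⇒lookup y∈f))))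

∩-monoˡ-⊆ : {p q : Subset n} (r : Subset n) → p ⊆ q → p ∩ r ⊆ q ∩ r
∩-monoˡ-⊆ {p = p} r p⊆q x∈p∩r with x∈p∩q⁻ p r x∈p∩r
... | x∈p , x∈r = x∈p∩q⁺ (p⊆q x∈p , x∈r)

∧-true⇒ˡ : ∀ a {b} → a ∧ b ≡ true → a ≡ true
∧-true⇒ˡ true _ = refl

isUV-away : (u v x y : Fin n) → ¬ x ≡ u → ¬ x ≡ v → isUV u v x y ≡ false
isUV-away u v x y x≢u x≢v with x ≟ u | x ≟ v
... | yes x≡u | _         = ⊥-elim (x≢u x≡u)
... | no _    | yes x≡v   = ⊥-elim (x≢v x≡v)
... | no _    | no _      = refl

nbhd-deleteEdge-⊆ : (G : Graph n) (u v x : Fin n) →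
                    nbhd (deleteEdge G u v) x ⊆ nbhd G x
nbhd-deleteEdge-⊆ G u v x =
  tabulate-mono _ _ (λ y → ∧-true⇒ˡ (adj G x y))

nbhd-deleteEdge-away : (G : Graph n) (u v x : Fin n) → ¬ x ≡ u → ¬ x ≡ v →
                       nbhd (deleteEdge G u v) x ≡ nbhd G x
nbhd-deleteEdge-away G u v x x≢u x≢v = tabulate-cong λ y →
  trans (cong (λ b → adj G x y ∧ not b) (isUV-away u v x y x≢u x≢v))
        (∧-identityʳ (adj G x y))

degreeMinus-mono : (H G : Graph n) (S : Subset n) (x : Fin n) →
                   nbhd H x ⊆ nbhd G x → degreeMinus H S x ≤ degreeMinus G S x
degreeMinus-mono H G S x H⊆G = p⊆q⇒∣p∣≤∣q∣ (∩-monoˡ-⊆ (∁ S) H⊆G)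

degreeMinus≤degree : (G : Graph n) (S : Subset n) (x : Fin n) →
                     degreeMinus G S x ≤ degree G x
degreeMinus≤degree G S x = ∣p∩q∣≤∣p∣ (nbhd G x) (∁ S)

MaxDeg≤2After-deleteEdge⁺ : (G : Graph n) (u v : Fin n) (S : Subset n) →
                            MaxDeg≤2After G S → MaxDeg≤2After (deleteEdge G u v) S
MaxDeg≤2After-deleteEdge⁺ G u v S maxDeg x x∉S =
  ≤-trans (degreeMinus-mono (deleteEdge G u v) G S x (nbhd-deleteEdge-⊆ G u v x))
          (maxDeg x x∉S)

MaxDeg≤2After-deleteEdge⁻ : (G : Graph n) (u v : Fin n) (S : Subset n) →
                            degree G u ≤ 2 → degree G v ≤ 2 →
                            MaxDeg≤2After (deleteEdge G u v) S → MaxDeg≤2After G S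
MaxDeg≤2After-deleteEdge⁻ G u v S du dv maxDeg x x∉S with x ≟ u | x ≟ v
... | yes refl | _        = ≤-trans (degreeMinus≤degree G S x) du
... | no _     | yes refl = ≤-trans (degreeMinus≤degree G S x) dv
... | no x≢u   | no x≢v   =
  subst (λ N → ∣ N ∩ ∁ S ∣ ≤ 2) (nbhd-deleteEdge-away G u v x x≢u x≢v) (maxDeg x x∉S)

lemma8 : ∀ {n} (G : Graph n) (k : ℤ) (u v : Fin n) →
    adj G u v ≡ true → degree G u ≤ 2 → degree G v ≤ 2 →
    (CoPathCyclePacking G k ⇔ CoPathCyclePacking (deleteEdge G u v) k)
lemma8 G k u v _ du dv = mk⇔
  (λ (S , size , maxDeg) → S , size , MaxDeg≤2After-deleteEdge⁺ G u v S maxDeg)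
  (λ (S , size , maxDeg) → S , size , MaxDeg≤2After-deleteEdge⁻ G u v S du dv maxDeg)
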